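{- Let $T(n)=\sum_{k=0}^{n}\left[\binom{ -n+7k}{n+k}\binom{n}{k}\bmod 2\right]$ for $n\ge 0$. Let $(S(n))_{n\ge0}$ be defined by $S(0)=S(1)=S(2)=1$ and $S(n)=S(n-2)+S(n-3)$ for $n\ge 3$ (the Padovan numbers, OEIS A000931, starting at offset $5$: $1,1,1,2,2,3,4,5,\dots$). Then $T$ is the run length transform of $S$.
   Context: For integers $a$ and $b\ge0$, $\binom{a}{b}=0$ whenever $a<b$ (in particular whenever $a<0$). $[x \bmod 2]$ denotes the residue in $\{0,1\}$. The run length transform of a sequence $(S(n))_{n\ge0}$ is $T(n)=\prod_{i\in\mathcal{L}(n)}S(i)$, where $\mathcal{L}(n)$ is the multiset of lengths of all maximal runs of $1$'s in the binary representation of $n$ (so $T(0)=1$). -}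

module Defs where

open import Data.Nat using (ℕ; zero; suc; _+_; _*_; _≡ᵇ_)
open import Data.Nat.DivMod using (_/_; _%_)
open import Data.Nat.Combinatorics using (_C_)
open import Data.Integer using (ℤ; +_; -[1+_]; -_) renaming (_+_ to _+ℤ_; _*_ to _*ℤ_)
open import Data.Bool using (Bool; true; false)
open import Data.List using (List; []; _∷_; _++_; map; upTo)
open import Data.Nat.ListAction using (sum; product)

-- Binomial coefficient with integer top and natural bottom:
-- binomial a b = 0 whenever a < 0 (and, via _C_, whenever a < b).
binomial : ℤ → ℕ → ℕ
binomial (+ a)    b = a C b
binomial -[1+ _ ] b = 0

Tseq : ℕ → ℕ
Tseq n = sum (map (λ k → (binomial (- (+ n) +ℤ (+ 7) *ℤ (+ k)) (n + k) * (n C k)) % 2)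
                  (upTo (suc n)))

S : ℕ → ℕ
S 0 = 1
S 1 = 1
S 2 = 1
S (suc (suc (suc n))) = S (suc n) + S n

-- binary digits of n, least significant first (fuel-based; fuel n suffices)
bitsFuel : ℕ → ℕ → List Bool
bitsFuel zero    _       = []
bitsFuel (suc f) zero    = []
bitsFuel (suc f) (suc m) = ((suc m % 2) ≡ᵇ 1) ∷ bitsFuel f (suc m / 2)

bits : ℕ → List Bool
bits n = bitsFuel n n

runsAcc : ℕ → List Bool → List ℕ
runsAcc zero    []           = []
runsAcc (suc c) []           = suc c ∷ []
runsAcc c       (true ∷ bs)  = runsAcc (suc c) bs
runsAcc zero    (false ∷ bs) = runsAcc zero bs
runsAcc (suc c) (false ∷ bs) = suc c ∷ runsAcc zero bs

runLengths : ℕ → List ℕ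
runLengths n = runsAcc zero (bits n)

runLengthTransform : (ℕ → ℕ) → ℕ → ℕ
runLengthTransform f n = product (map f (runLengths n))

-- Write n = ν + 2m and k = κ + 2j with digits ν, κ. By Lucas' theorem mod 2, the k-th term of the
-- sum T_{c₁,c₂}(n), whose binomial coefficient has bottom index n + k + c₁ and top index
-- - n + 7k + c₂, is either 0 or the j-th term of T_{c₁′,c₂′}(m), where c₁′, c₂′ are the carries of
-- halving the two indices. Hence T_{c₁,c₂}(2m + ν) is a sum of at most two values T_{c₁′,c₂′}(m).
-- Starting from T = T_{0,0} only nine shifts occur, and induction on the binary digits matches their
-- recursion with that of the run length transform of S, where a pending run of c ones contributes
-- S c at the next 0 and S (c + 3) = S (c + 1) + S c.
module Submission where

open import Data.Bool using (Bool; true; false; not; _∧_; _∨_)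
open import Data.Integer using (ℤ; +_; -[1+_]; -_; 0ℤ; 1ℤ; -1ℤ) renaming (_+_ to _+ℤ_; _*_ to _*ℤ_; _-_ to _-ℤ_)
import Data.Integer.Properties as ℤ
import Data.Integer.Tactic.RingSolver as ℤ-Solver
open import Data.List using (List; []; _∷_; map; applyUpTo)
open import Data.Nat
open import Data.Nat.Combinatorics using (_C_; nCk+nC[k+1]≡[n+1]C[k+1]; nC1≡n)
open import Data.Nat.DivMod using (_%_; _/_; %-distribˡ-+; %-distribˡ-*; [m+kn]%n≡m%n; m/n≡1+[m∸n]/n; m/n<m)
open import Data.Nat.Induction using (<-rec)
open import Data.Nat.ListAction using (sum; product)
open import Data.Nat.Properties
open import Algebra.Properties.CommutativeSemigroup +-commutativeSemigroup using (x∙yz≈xz∙y)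
import Data.Nat.Tactic.RingSolver as ℕ-Solver
open import Data.Product using (_×_; _,_; proj₁; proj₂; map₁)
open import Function using (_∘_)
open import Relation.Binary.Bundles using (Setoid)
import Relation.Binary.Reasoning.Setoid
open import Relation.Binary.Structures using (IsEquivalence)
open import Relation.Binary.PropositionalEquality

open import Defs

bit : Bool → ℕ
bit false = 0
bit true  = 1

double : ℕ → ℕ
double zero    = 0
double (suc n) = suc (suc (double n))

double≡2* : ∀ n → double n ≡ 2 * n
double≡2* zero    = refl
double≡2* (suc n) = cong suc (trans (cong suc (double≡2* n)) (sym (+-suc n (n + 0))))

halve : ℕ → ℕ × Bool
halve 0             = 0 , false
halve 1             = 0 , true
halve (suc (suc n)) = map₁ suc (halve n)

halve-spec : ∀ n → n ≡ bit (proj₂ (halve n)) + double (proj₁ (halve n))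
halve-spec 0             = refl
halve-spec 1             = refl
halve-spec (suc (suc n)) =
  trans (cong (suc ∘ suc) (halve-spec n)) (sym (trans (+-suc _ _) (cong suc (+-suc _ _))))

halve-≤ : ∀ n → proj₁ (halve n) ≤ n
halve-≤ 0             = z≤n
halve-≤ 1             = z≤n
halve-≤ (suc (suc n)) = s≤s (m≤n⇒m≤1+n (halve-≤ n))

halve-< : ∀ n → proj₁ (halve (suc n)) < suc n
halve-< zero    = s≤s z≤n
halve-< (suc n) = s≤s (s≤s (halve-≤ n))

binary-induction : ∀ {ℓ} (P : ℕ → Set ℓ) → P 0 → (∀ ν m → P m → P (bit ν + double m)) → ∀ n → P n
binary-induction P P0 step = <-rec P go
  where
  go : ∀ n → (∀ {m} → m < n → P m) → P n
  go zero    _   = P0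
  go (suc n) rec = subst P (sym (halve-spec (suc n))) (step _ _ (rec (halve-< n)))

+-digits : ∀ ν m → + (bit ν + double m) ≡ + bit ν +ℤ + 2 *ℤ + m
+-digits ν m = trans (ℤ.pos-+ (bit ν) (double m)) (cong (+ bit ν +ℤ_) (trans (cong +_ (double≡2* m)) (ℤ.pos-* 2 m)))

halveℤ : ℤ → ℤ × Bool
halveℤ (+ n)    = map₁ +_ (halve n)
halveℤ -[1+ n ] = -[1+ proj₁ (halve n) ] , not (proj₂ (halve n))

-[1+digits] : ∀ ν m → -[1+ bit ν + double m ] ≡ + bit (not ν) +ℤ + 2 *ℤ -[1+ m ]
-[1+digits] ν m = begin
  - (+ 1 +ℤ + (bit ν + double m))             ≡⟨ cong (λ z → - (+ 1 +ℤ z)) (+-digits ν m) ⟩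
  - (+ 1 +ℤ (+ bit ν +ℤ + 2 *ℤ + m))          ≡⟨ identity (+ bit ν) (+ m) ⟩
  (1ℤ -ℤ + bit ν) +ℤ + 2 *ℤ - (+ 1 +ℤ + m)    ≡⟨ cong₂ (λ b z → b +ℤ + 2 *ℤ - z) (not-bit ν) (ℤ.pos-+ 1 m) ⟨
  + bit (not ν) +ℤ + 2 *ℤ -[1+ m ]            ∎
  where
  open ≡-Reasoning
  identity : ∀ b m → - (+ 1 +ℤ (b +ℤ + 2 *ℤ m)) ≡ (1ℤ -ℤ b) +ℤ + 2 *ℤ - (+ 1 +ℤ m)
  identity = ℤ-Solver.solve-∀
  not-bit : ∀ ν → + bit (not ν) ≡ 1ℤ -ℤ + bit ν
  not-bit false = refl
  not-bit true  = refl

halveℤ-spec : ∀ z → z ≡ + bit (proj₂ (halveℤ z)) +ℤ + 2 *ℤ proj₁ (halveℤ z)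
halveℤ-spec (+ n) = trans (cong +_ (halve-spec n)) (+-digits (proj₂ (halve n)) (proj₁ (halve n)))
halveℤ-spec -[1+ n ] with halve n | halve-spec n
... | q , ν | refl = -[1+digits] ν q

infix 4 _≡₂_
record _≡₂_ (x y : ℕ) : Set where
  constructor mod₂
  field mod₂-≡ : x % 2 ≡ y % 2
open _≡₂_

≡⇒≡₂ : ∀ {x y} → x ≡ y → x ≡₂ y
≡⇒≡₂ x≡y = mod₂ (cong (_% 2) x≡y)

≡₂-isEquivalence : IsEquivalence _≡₂_
≡₂-isEquivalence = record
  { refl  = mod₂ refl
  ; sym   = λ x≡₂y → mod₂ (sym (mod₂-≡ x≡₂y))
  ; trans = λ x≡₂y y≡₂z → mod₂ (trans (mod₂-≡ x≡₂y) (mod₂-≡ y≡₂z))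
  }

≡₂-setoid : Setoid _ _
≡₂-setoid = record { isEquivalence = ≡₂-isEquivalence }

open IsEquivalence ≡₂-isEquivalence using () renaming (trans to ≡₂-trans)

module ≡₂-Reasoning = Relation.Binary.Reasoning.Setoid ≡₂-setoid

+-cong-≡₂ : ∀ {x x′ y y′} → x ≡₂ x′ → y ≡₂ y′ → x + y ≡₂ x′ + y′
+-cong-≡₂ {x} {x′} {y} {y′} (mod₂ p) (mod₂ q) = mod₂ (begin
  (x + y) % 2              ≡⟨ %-distribˡ-+ x y 2 ⟩
  (x % 2 + y % 2) % 2      ≡⟨ cong₂ (λ a b → (a + b) % 2) p q ⟩
  (x′ % 2 + y′ % 2) % 2    ≡⟨ %-distribˡ-+ x′ y′ 2 ⟨
  (x′ + y′) % 2            ∎)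
  where open ≡-Reasoning

*-cong-≡₂ : ∀ {x x′ y y′} → x ≡₂ x′ → y ≡₂ y′ → x * y ≡₂ x′ * y′
*-cong-≡₂ {x} {x′} {y} {y′} (mod₂ p) (mod₂ q) = mod₂ (begin
  (x * y) % 2              ≡⟨ %-distribˡ-* x y 2 ⟩
  (x % 2 * (y % 2)) % 2    ≡⟨ cong₂ (λ a b → (a * b) % 2) p q ⟩
  (x′ % 2 * (y′ % 2)) % 2  ≡⟨ %-distribˡ-* x′ y′ 2 ⟨
  (x′ * y′) % 2            ∎)
  where open ≡-Reasoning

[2+n]C[2+k]≡nC[2+k]+nCk+nC[1+k]*2 : ∀ n k → (2 + n) C (2 + k) ≡ n C (2 + k) + n C k + (n C (1 + k)) * 2
[2+n]C[2+k]≡nC[2+k]+nCk+nC[1+k]*2 n k = begin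
  (2 + n) C (2 + k)                                     ≡⟨ nCk+nC[k+1]≡[n+1]C[k+1] (1 + n) (1 + k) ⟨
  (1 + n) C (1 + k) + (1 + n) C (2 + k)                 ≡⟨ cong₂ _+_ (nCk+nC[k+1]≡[n+1]C[k+1] n k)
                                                                     (nCk+nC[k+1]≡[n+1]C[k+1] n (1 + k)) ⟨
  n C k + n C (1 + k) + (n C (1 + k) + n C (2 + k))     ≡⟨ rearrange (n C k) (n C (1 + k)) (n C (2 + k)) ⟩
  n C (2 + k) + n C k + (n C (1 + k)) * 2               ∎
  where
  open ≡-Reasoning
  rearrange : ∀ a b c → a + b + (b + c) ≡ c + a + b * 2
  rearrange = ℕ-Solver.solve-∀

[2+n]C[2+k]≡₂nC[2+k]+nCk : ∀ n k → (2 + n) C (2 + k) ≡₂ n C (2 + k) + n C k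
[2+n]C[2+k]≡₂nC[2+k]+nCk n k = mod₂ (trans (cong (_% 2) ([2+n]C[2+k]≡nC[2+k]+nCk+nC[1+k]*2 n k))
                                           ([m+kn]%n≡m%n (n C (2 + k) + n C k) (n C (1 + k)) 2))

[2+n]C1≡₂nC1 : ∀ n → (2 + n) C 1 ≡₂ n C 1
[2+n]C1≡₂nC1 n = mod₂ (trans (cong (_% 2) (nC1≡n (2 + n))) (cong (_% 2) (sym (nC1≡n n))))

lucas-even : ∀ a b → double a C double b ≡₂ a C b
lucas-even zero    zero    = mod₂ refl
lucas-even zero    (suc b) = mod₂ refl
lucas-even (suc a) zero    = mod₂ refl
lucas-even (suc a) (suc b) = begin
  double (suc a) C double (suc b)                    ≈⟨ [2+n]C[2+k]≡₂nC[2+k]+nCk (double a) (double b) ⟩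
  double a C double (suc b) + double a C double b    ≈⟨ +-cong-≡₂ (lucas-even a (suc b)) (lucas-even a b) ⟩
  a C suc b + a C b                                  ≡⟨ +-comm (a C suc b) (a C b) ⟩
  a C b + a C suc b                                  ≡⟨ nCk+nC[k+1]≡[n+1]C[k+1] a b ⟩
  suc a C suc b                                      ∎
  where open ≡₂-Reasoning

lucas-odd : ∀ a b → double a C suc (double b) ≡₂ 0
lucas-odd zero    b       = mod₂ refl
lucas-odd (suc a) zero    = ≡₂-trans ([2+n]C1≡₂nC1 (double a)) (lucas-odd a zero)
lucas-odd (suc a) (suc b) = begin
  double (suc a) C suc (double (suc b))                          ≈⟨ [2+n]C[2+k]≡₂nC[2+k]+nCk (double a) (suc (double b)) ⟩
  double a C suc (double (suc b)) + double a C suc (double b)    ≈⟨ +-cong-≡₂ (lucas-odd a (suc b)) (lucas-odd a b) ⟩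
  0                                                              ∎
  where open ≡₂-Reasoning

infixr 7 _·_
_·_ : Bool → ℕ → ℕ
true  · n = n
false · n = 0

·-zeroʳ : ∀ w → w · 0 ≡ 0
·-zeroʳ true  = refl
·-zeroʳ false = refl

·-*-· : ∀ v w m n → (v · m) * (w · n) ≡ (w ∧ v) · (m * n)
·-*-· true  true  m n = refl
·-*-· true  false m n = *-zeroʳ m
·-*-· false true  m n = refl
·-*-· false false m n = refl

·-%2 : ∀ w n → (w · n) % 2 ≡ w · (n % 2)
·-%2 true  n = refl
·-%2 false n = refl

lucas-digits : ∀ ν κ m j → (bit ν + double m) C (bit κ + double j) ≡₂ (not κ ∨ ν) · (m C j)
lucas-digits false false m j       = lucas-even m j
lucas-digits false true  m j       = lucas-odd m j
lucas-digits true  false m zero    = mod₂ refl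
lucas-digits true  false m (suc j) = begin
  suc (double m) C double (suc j)                           ≡⟨ nCk+nC[k+1]≡[n+1]C[k+1] (double m) (suc (double j)) ⟨
  double m C suc (double j) + double m C double (suc j)     ≈⟨ +-cong-≡₂ (lucas-odd m j) (lucas-even m (suc j)) ⟩
  m C suc j                                                 ∎
  where open ≡₂-Reasoning
lucas-digits true  true  m j       = begin
  suc (double m) C suc (double j)                           ≡⟨ nCk+nC[k+1]≡[n+1]C[k+1] (double m) (double j) ⟨
  double m C double j + double m C suc (double j)           ≈⟨ +-cong-≡₂ (lucas-even m j) (lucas-odd m j) ⟩
  m C j + 0                                                 ≡⟨ +-identityʳ (m C j) ⟩
  m C j                                                     ∎
  where open ≡₂-Reasoning

binomial-negative-digits : ∀ τ a b → binomial (+ bit τ +ℤ + 2 *ℤ -[1+ a ]) b ≡ 0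
binomial-negative-digits false zero    b = refl
binomial-negative-digits false (suc a) b = refl
binomial-negative-digits true  zero    b = refl
binomial-negative-digits true  (suc a) b = refl

lucas-digits-ℤ : ∀ τ σ A b → binomial (+ bit τ +ℤ + 2 *ℤ A) (bit σ + double b) ≡₂ (not σ ∨ τ) · binomial A b
lucas-digits-ℤ τ σ (+ a)    b = begin
  binomial (+ bit τ +ℤ + 2 *ℤ + a) (bit σ + double b)   ≡⟨ cong (λ z → binomial z (bit σ + double b)) (+-digits τ a) ⟨
  (bit τ + double a) C (bit σ + double b)               ≈⟨ lucas-digits τ σ a b ⟩
  (not σ ∨ τ) · (a C b)                                 ∎
  where open ≡₂-Reasoning
lucas-digits-ℤ τ σ -[1+ a ] b =
  ≡⇒≡₂ (trans (binomial-negative-digits τ a (bit σ + double b)) (sym (·-zeroʳ (not σ ∨ τ))))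

sumBelow : ℕ → (ℕ → ℕ) → ℕ
sumBelow zero    f = 0
sumBelow (suc n) f = f 0 + sumBelow n (f ∘ suc)

sum-map-applyUpTo : ∀ {A : Set} (f : A → ℕ) g n → sum (map f (applyUpTo g n)) ≡ sumBelow n (f ∘ g)
sum-map-applyUpTo f g zero    = refl
sum-map-applyUpTo f g (suc n) = cong (_+_ (f (g 0))) (sum-map-applyUpTo f (g ∘ suc) n)

sumBelow-cong : ∀ {f g} → (∀ k → f k ≡ g k) → ∀ n → sumBelow n f ≡ sumBelow n g
sumBelow-cong f≡g zero    = refl
sumBelow-cong f≡g (suc n) = cong₂ _+_ (f≡g 0) (sumBelow-cong (f≡g ∘ suc) n)

sumBelow-zero : ∀ n → sumBelow n (λ _ → 0) ≡ 0
sumBelow-zero zero    = refl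
sumBelow-zero (suc n) = sumBelow-zero n

sumBelow-· : ∀ w f n → sumBelow n (λ k → w · f k) ≡ w · sumBelow n f
sumBelow-· true  f n = refl
sumBelow-· false f n = sumBelow-zero n

sumBelow-double     : ∀ n f → sumBelow (double n) f ≡ sumBelow n (f ∘ double) + sumBelow n (f ∘ suc ∘ double)
sumBelow-suc-double : ∀ n f → sumBelow (suc (double n)) f ≡ sumBelow (suc n) (f ∘ double) + sumBelow n (f ∘ suc ∘ double)

sumBelow-double zero    f = refl
sumBelow-double (suc n) f =
  trans (cong (_+_ (f 0)) (sumBelow-suc-double n (f ∘ suc))) (x∙yz≈xz∙y (f 0) _ _)

sumBelow-suc-double n f =
  trans (cong (_+_ (f 0)) (sumBelow-double n (f ∘ suc))) (x∙yz≈xz∙y (f 0) _ _)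

summand : ℕ → ℕ → ℤ → ℕ → ℕ
summand n c₁ c₂ k = (binomial (- (+ n) +ℤ + 7 *ℤ + k +ℤ c₂) (n + k + c₁) * (n C k)) % 2

shiftedT : ℕ → ℕ → ℤ → ℕ
shiftedT n c₁ c₂ = sumBelow (suc n) (summand n c₁ c₂)

Tseq≡shiftedT : ∀ n → Tseq n ≡ shiftedT n 0 0ℤ
Tseq≡shiftedT n = trans (sum-map-applyUpTo _ (λ k → k) (suc n)) (sumBelow-cong unshift (suc n))
  where
  unshift : ∀ k → (binomial (- (+ n) +ℤ + 7 *ℤ + k) (n + k) * (n C k)) % 2 ≡ summand n 0 0ℤ k
  unshift k = cong (_% 2) (cong₂ (λ a b → binomial a b * (n C k))
                                 (sym (ℤ.+-identityʳ (- (+ n) +ℤ + 7 *ℤ + k))) (sym (+-identityʳ (n + k))))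

bottom-digits : ∀ ν κ σ m j c₁ c₁′ → bit ν + bit κ + c₁ ≡ bit σ + double c₁′ →
                bit ν + double m + (bit κ + double j) + c₁ ≡ bit σ + double (m + j + c₁′)
bottom-digits ν κ σ m j c₁ c₁′ carry = begin
  bit ν + double m + (bit κ + double j) + c₁
    ≡⟨ cong₂ (λ x y → bit ν + x + (bit κ + y) + c₁) (double≡2* m) (double≡2* j) ⟩
  bit ν + 2 * m + (bit κ + 2 * j) + c₁
    ≡⟨ split (bit ν) (bit κ) c₁ m j ⟩
  (bit ν + bit κ + c₁) + 2 * (m + j)
    ≡⟨ cong (_+ 2 * (m + j)) (trans carry (cong (_+_ (bit σ)) (double≡2* c₁′))) ⟩
  bit σ + 2 * c₁′ + 2 * (m + j)
    ≡⟨ merge (bit σ) c₁′ m j ⟩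
  bit σ + 2 * (m + j + c₁′)
    ≡⟨ cong (_+_ (bit σ)) (double≡2* (m + j + c₁′)) ⟨
  bit σ + double (m + j + c₁′)
    ∎
  where
  open ≡-Reasoning
  split : ∀ a b c m j → a + 2 * m + (b + 2 * j) + c ≡ (a + b + c) + 2 * (m + j)
  split = ℕ-Solver.solve-∀
  merge : ∀ s c m j → s + 2 * c + 2 * (m + j) ≡ s + 2 * (m + j + c)
  merge = ℕ-Solver.solve-∀

top-digits : ∀ ν κ τ m j c₂ c₂′ → + 7 *ℤ + bit κ +ℤ c₂ -ℤ + bit ν ≡ + bit τ +ℤ + 2 *ℤ c₂′ →
             - (+ (bit ν + double m)) +ℤ + 7 *ℤ + (bit κ + double j) +ℤ c₂
               ≡ + bit τ +ℤ + 2 *ℤ (- (+ m) +ℤ + 7 *ℤ + j +ℤ c₂′)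
top-digits ν κ τ m j c₂ c₂′ carry = begin
  - (+ (bit ν + double m)) +ℤ + 7 *ℤ + (bit κ + double j) +ℤ c₂
    ≡⟨ cong₂ (λ x y → - x +ℤ + 7 *ℤ y +ℤ c₂) (+-digits ν m) (+-digits κ j) ⟩
  - (+ bit ν +ℤ + 2 *ℤ + m) +ℤ + 7 *ℤ (+ bit κ +ℤ + 2 *ℤ + j) +ℤ c₂
    ≡⟨ split (+ bit ν) (+ bit κ) c₂ (+ m) (+ j) ⟩
  (+ 7 *ℤ + bit κ +ℤ c₂ -ℤ + bit ν) +ℤ + 2 *ℤ (- (+ m) +ℤ + 7 *ℤ + j)
    ≡⟨ cong (_+ℤ + 2 *ℤ (- (+ m) +ℤ + 7 *ℤ + j)) carry ⟩
  + bit τ +ℤ + 2 *ℤ c₂′ +ℤ + 2 *ℤ (- (+ m) +ℤ + 7 *ℤ + j)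
    ≡⟨ merge (+ bit τ) c₂′ (+ m) (+ j) ⟩
  + bit τ +ℤ + 2 *ℤ (- (+ m) +ℤ + 7 *ℤ + j +ℤ c₂′)
    ∎
  where
  open ≡-Reasoning
  split : ∀ a b c m j → - (a +ℤ + 2 *ℤ m) +ℤ + 7 *ℤ (b +ℤ + 2 *ℤ j) +ℤ c
                          ≡ (+ 7 *ℤ b +ℤ c -ℤ a) +ℤ + 2 *ℤ (- m +ℤ + 7 *ℤ j)
  split = ℤ-Solver.solve-∀
  merge : ∀ t c m j → t +ℤ + 2 *ℤ c +ℤ + 2 *ℤ (- m +ℤ + 7 *ℤ j) ≡ t +ℤ + 2 *ℤ (- m +ℤ + 7 *ℤ j +ℤ c)
  merge = ℤ-Solver.solve-∀

summand-digits′ : ∀ ν κ σ τ m j c₁ c₂ c₁′ c₂′ →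
                  bit ν + bit κ + c₁ ≡ bit σ + double c₁′ →
                  + 7 *ℤ + bit κ +ℤ c₂ -ℤ + bit ν ≡ + bit τ +ℤ + 2 *ℤ c₂′ →
                  summand (bit ν + double m) c₁ c₂ (bit κ + double j)
                    ≡ ((not κ ∨ ν) ∧ (not σ ∨ τ)) · summand m c₁′ c₂′ j
summand-digits′ ν κ σ τ m j c₁ c₂ c₁′ c₂′ carry₁ carry₂ = begin
  (binomial top bottom * (n C k)) % 2
    ≡⟨ cong (_% 2) (cong₂ (λ t b → binomial t b * (n C k))
                          (top-digits ν κ τ m j c₂ c₂′ carry₂) (bottom-digits ν κ σ m j c₁ c₁′ carry₁)) ⟩
  (binomial (+ bit τ +ℤ + 2 *ℤ A) (bit σ + double B) * (n C k)) % 2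
    ≡⟨ mod₂-≡ (*-cong-≡₂ (lucas-digits-ℤ τ σ A B) (lucas-digits ν κ m j)) ⟩
  (((not σ ∨ τ) · binomial A B) * ((not κ ∨ ν) · (m C j))) % 2
    ≡⟨ cong (_% 2) (·-*-· (not σ ∨ τ) (not κ ∨ ν) (binomial A B) (m C j)) ⟩
  (((not κ ∨ ν) ∧ (not σ ∨ τ)) · (binomial A B * (m C j))) % 2
    ≡⟨ ·-%2 ((not κ ∨ ν) ∧ (not σ ∨ τ)) (binomial A B * (m C j)) ⟩
  ((not κ ∨ ν) ∧ (not σ ∨ τ)) · summand m c₁′ c₂′ j
    ∎
  where
  open ≡-Reasoning
  n = bit ν + double m
  k = bit κ + double j
  top = - (+ n) +ℤ + 7 *ℤ + k +ℤ c₂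
  bottom = n + k + c₁
  A = - (+ m) +ℤ + 7 *ℤ + j +ℤ c₂′
  B = m + j + c₁′

-- For n = ν + 2m and k = κ + 2j, with (c₁′ , σ) = carry₁ ν κ c₁ and (c₂′ , τ) = carry₂ ν κ c₂,
-- the indices of the first binomial coefficient split as n + k + c₁ = σ + 2 (m + j + c₁′)
-- and - n + 7 k + c₂ = τ + 2 (- m + 7 j + c₂′).
carry₁ : Bool → Bool → ℕ → ℕ × Bool
carry₁ ν κ c₁ = halve (bit ν + bit κ + c₁)

carry₂ : Bool → Bool → ℤ → ℤ × Bool
carry₂ ν κ c₂ = halveℤ (+ 7 *ℤ + bit κ +ℤ c₂ -ℤ + bit ν)

weight : Bool → Bool → ℕ → ℤ → Bool
weight ν κ c₁ c₂ = (not κ ∨ ν) ∧ (not (proj₂ (carry₁ ν κ c₁)) ∨ proj₂ (carry₂ ν κ c₂))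

summand-digits : ∀ ν κ c₁ c₂ m j →
                 summand (bit ν + double m) c₁ c₂ (bit κ + double j)
                   ≡ weight ν κ c₁ c₂ · summand m (proj₁ (carry₁ ν κ c₁)) (proj₁ (carry₂ ν κ c₂)) j
summand-digits ν κ c₁ c₂ m j =
  summand-digits′ ν κ (proj₂ (carry₁ ν κ c₁)) (proj₂ (carry₂ ν κ c₂)) m j c₁ c₂ _ _
    (halve-spec (bit ν + bit κ + c₁)) (halveℤ-spec (+ 7 *ℤ + bit κ +ℤ c₂ -ℤ + bit ν))

digitContribution : Bool → Bool → ℕ → ℤ → ℕ → ℕ
digitContribution ν κ c₁ c₂ m = weight ν κ c₁ c₂ · shiftedT m (proj₁ (carry₁ ν κ c₁)) (proj₁ (carry₂ ν κ c₂))

shiftedT-even : ∀ m c₁ c₂ → shiftedT (double m) c₁ c₂ ≡ digitContribution false false c₁ c₂ m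
shiftedT-even m c₁ c₂ = begin
  sumBelow (suc (double m)) f
    ≡⟨ sumBelow-suc-double m f ⟩
  sumBelow (suc m) (f ∘ double) + sumBelow m (f ∘ suc ∘ double)
    ≡⟨ cong₂ _+_ (sumBelow-cong (summand-digits false false c₁ c₂ m) (suc m))
                 (sumBelow-cong (summand-digits false true c₁ c₂ m) m) ⟩
  sumBelow (suc m) (λ j → w · g j) + sumBelow m (λ _ → 0)
    ≡⟨ cong₂ _+_ (sumBelow-· w g (suc m)) (sumBelow-zero m) ⟩
  digitContribution false false c₁ c₂ m + 0
    ≡⟨ +-identityʳ _ ⟩
  digitContribution false false c₁ c₂ m
    ∎
  where
  open ≡-Reasoning
  f = summand (double m) c₁ c₂
  w = weight false false c₁ c₂
  g = summand m (proj₁ (carry₁ false false c₁)) (proj₁ (carry₂ false false c₂))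

shiftedT-odd : ∀ m c₁ c₂ → shiftedT (suc (double m)) c₁ c₂
                            ≡ digitContribution true false c₁ c₂ m + digitContribution true true c₁ c₂ m
shiftedT-odd m c₁ c₂ = begin
  sumBelow (double (suc m)) f
    ≡⟨ sumBelow-double (suc m) f ⟩
  sumBelow (suc m) (f ∘ double) + sumBelow (suc m) (f ∘ suc ∘ double)
    ≡⟨ cong₂ _+_ (sumBelow-cong (summand-digits true false c₁ c₂ m) (suc m))
                 (sumBelow-cong (summand-digits true true c₁ c₂ m) (suc m)) ⟩
  sumBelow (suc m) (λ j → w false · g false j) + sumBelow (suc m) (λ j → w true · g true j)
    ≡⟨ cong₂ _+_ (sumBelow-· (w false) (g false) (suc m)) (sumBelow-· (w true) (g true) (suc m)) ⟩
  digitContribution true false c₁ c₂ m + digitContribution true true c₁ c₂ m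
    ∎
  where
  open ≡-Reasoning
  f = summand (suc (double m)) c₁ c₂
  w : Bool → Bool
  w κ = weight true κ c₁ c₂
  g : Bool → ℕ → ℕ
  g κ = summand m (proj₁ (carry₁ true κ c₁)) (proj₁ (carry₂ true κ c₂))

runProduct : ℕ → List Bool → ℕ
runProduct c bs = product (map S (runsAcc c bs))

runProduct-[] : ∀ c → runProduct c [] ≡ S c
runProduct-[] zero    = refl
runProduct-[] (suc c) = *-identityʳ (S (suc c))

runProduct-true : ∀ c bs → runProduct c (true ∷ bs) ≡ runProduct (suc c) bs
runProduct-true zero    bs = refl
runProduct-true (suc c) bs = refl

runProduct-false : ∀ c bs → runProduct c (false ∷ bs) ≡ S c * runProduct 0 bs
runProduct-false zero    bs = sym (+-identityʳ (runProduct 0 bs))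
runProduct-false (suc c) bs = refl

runProduct-padovan : ∀ c bs → runProduct (3 + c) bs ≡ runProduct (1 + c) bs + runProduct c bs
runProduct-padovan c []           = trans (runProduct-[] (3 + c)) (sym (cong₂ _+_ (runProduct-[] (1 + c)) (runProduct-[] c)))
runProduct-padovan c (true ∷ bs)  =
  trans (runProduct-padovan (suc c) bs) (sym (cong₂ _+_ (runProduct-true (1 + c) bs) (runProduct-true c bs)))
runProduct-padovan c (false ∷ bs) = begin
  S (3 + c) * runProduct 0 bs                                ≡⟨ *-distribʳ-+ (runProduct 0 bs) (S (1 + c)) (S c) ⟩
  S (1 + c) * runProduct 0 bs + S c * runProduct 0 bs        ≡⟨ cong₂ _+_ (runProduct-false (1 + c) bs) (runProduct-false c bs) ⟨
  runProduct (1 + c) (false ∷ bs) + runProduct c (false ∷ bs) ∎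
  where open ≡-Reasoning

-- the run length transform of n after c further 1's are appended below its lowest binary digit
rltCarry : ℕ → ℕ → ℕ
rltCarry c n = runProduct c (bits n)

suc-/2≤ : ∀ n → suc n / 2 ≤ n
suc-/2≤ n = s≤s⁻¹ (m/n<m (suc n) 2 (s≤s (s≤s z≤n)))

bitsFuel-irrelevant : ∀ {f f′} n → n ≤ f → n ≤ f′ → bitsFuel f n ≡ bitsFuel f′ n
bitsFuel-irrelevant {zero}  {zero}   zero    z≤n _   = refl
bitsFuel-irrelevant {zero}  {suc _}  zero    z≤n _   = refl
bitsFuel-irrelevant {suc _} {zero}   zero    _   z≤n = refl
bitsFuel-irrelevant {suc _} {suc _}  zero    _   _   = refl
bitsFuel-irrelevant {suc f} {suc f′} (suc n) (s≤s n≤f) (s≤s n≤f′) =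
  cong (_∷_ (suc n % 2 ≡ᵇ 1)) (bitsFuel-irrelevant (suc n / 2) (≤-trans (suc-/2≤ n) n≤f) (≤-trans (suc-/2≤ n) n≤f′))

bits-suc : ∀ n → bits (suc n) ≡ (suc n % 2 ≡ᵇ 1) ∷ bits (suc n / 2)
bits-suc n = cong (_∷_ (suc n % 2 ≡ᵇ 1)) (bitsFuel-irrelevant (suc n / 2) (suc-/2≤ n) ≤-refl)

digits-%2 : ∀ ν m → (bit ν + double m) % 2 ≡ bit ν
digits-%2 false zero    = refl
digits-%2 true  zero    = refl
digits-%2 false (suc m) = digits-%2 false m
digits-%2 true  (suc m) = digits-%2 true m

digits-/2 : ∀ ν m → (bit ν + double m) / 2 ≡ m
digits-/2 false zero    = refl
digits-/2 true  zero    = refl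
digits-/2 false (suc m) = trans (m/n≡1+[m∸n]/n {2 + double m} (s≤s (s≤s z≤n))) (cong suc (digits-/2 false m))
digits-/2 true  (suc m) = trans (m/n≡1+[m∸n]/n {3 + double m} (s≤s (s≤s z≤n))) (cong suc (digits-/2 true m))

rltCarry-odd : ∀ c m → rltCarry c (suc (double m)) ≡ rltCarry (suc c) m
rltCarry-odd c m = begin
  runProduct c (bits (suc (double m)))
    ≡⟨ cong (runProduct c) (bits-suc (double m)) ⟩
  runProduct c ((suc (double m) % 2 ≡ᵇ 1) ∷ bits (suc (double m) / 2))
    ≡⟨ cong₂ (λ b n → runProduct c (b ∷ bits n)) (cong (_≡ᵇ 1) (digits-%2 true m)) (digits-/2 true m) ⟩
  runProduct c (true ∷ bits m)
    ≡⟨ runProduct-true c (bits m) ⟩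
  runProduct (suc c) (bits m)
    ∎
  where open ≡-Reasoning

rltCarry-even : ∀ c m → rltCarry c (double m) ≡ S c * rltCarry 0 m
rltCarry-even c zero    = trans (runProduct-[] c) (sym (*-identityʳ (S c)))
rltCarry-even c (suc m) = begin
  runProduct c (bits (double (suc m)))
    ≡⟨ cong (runProduct c) (bits-suc (suc (double m))) ⟩
  runProduct c ((double (suc m) % 2 ≡ᵇ 1) ∷ bits (double (suc m) / 2))
    ≡⟨ cong₂ (λ b n → runProduct c (b ∷ bits n)) (cong (_≡ᵇ 1) (digits-%2 false (suc m))) (digits-/2 false (suc m)) ⟩
  runProduct c (false ∷ bits (suc m))
    ≡⟨ runProduct-false c (bits (suc m)) ⟩
  S c * rltCarry 0 (suc m)
    ∎
  where open ≡-Reasoning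

rltCarry-padovan : ∀ c n → rltCarry (3 + c) n ≡ rltCarry (1 + c) n + rltCarry c n
rltCarry-padovan c n = runProduct-padovan c (bits n)

-- The nine shifts below are closed under shiftedT-even and shiftedT-odd; shift (1 , 4) is pinned down
-- only together with rltCarry 0, which is where S (c + 3) = S (c + 1) + S c enters.
record ShiftedTValues (n : ℕ) : Set where
  field
    t₀₋₁ : shiftedT n 0 -1ℤ ≡ 0
    t₀₀  : shiftedT n 0 0ℤ ≡ rltCarry 0 n
    t₀₁  : shiftedT n 0 1ℤ ≡ rltCarry 0 n
    t₁₋₁ : shiftedT n 1 -1ℤ ≡ 0
    t₁₀  : shiftedT n 1 0ℤ ≡ 0
    t₁₁  : shiftedT n 1 1ℤ ≡ rltCarry 0 n
    t₁₂  : shiftedT n 1 (+ 2) ≡ 0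
    t₁₃  : shiftedT n 1 (+ 3) ≡ rltCarry 1 n
    t₁₄  : shiftedT n 1 (+ 4) + rltCarry 0 n ≡ rltCarry 2 n
open ShiftedTValues

shiftedTValues-zero : ShiftedTValues 0
shiftedTValues-zero = record
  { t₀₋₁ = refl ; t₀₀ = refl ; t₀₁ = refl ; t₁₋₁ = refl ; t₁₀ = refl
  ; t₁₁ = refl ; t₁₂ = refl ; t₁₃ = refl ; t₁₄ = refl }

-- For concrete shifts each digitContribution computes to 0 or to a single shiftedT m c₁′ c₂′.
shiftedTValues-even : ∀ m → ShiftedTValues m → ShiftedTValues (double m)
shiftedTValues-even m v = record
  { t₀₋₁ = trans (shiftedT-even m 0 -1ℤ) (t₀₋₁ v)
  ; t₀₀  = trans (shiftedT-even m 0 0ℤ) (trans (t₀₀ v) (sym (rltCarry-even-S≡1 0 refl)))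
  ; t₀₁  = trans (shiftedT-even m 0 1ℤ) (trans (t₀₀ v) (sym (rltCarry-even-S≡1 0 refl)))
  ; t₁₋₁ = trans (shiftedT-even m 1 -1ℤ) (t₀₋₁ v)
  ; t₁₀  = shiftedT-even m 1 0ℤ
  ; t₁₁  = trans (shiftedT-even m 1 1ℤ) (trans (t₀₀ v) (sym (rltCarry-even-S≡1 0 refl)))
  ; t₁₂  = shiftedT-even m 1 (+ 2)
  ; t₁₃  = trans (shiftedT-even m 1 (+ 3)) (trans (t₀₁ v) (sym (rltCarry-even-S≡1 1 refl)))
  ; t₁₄  = trans (cong (_+ rltCarry 0 (double m)) (shiftedT-even m 1 (+ 4)))
                 (trans (rltCarry-even-S≡1 0 refl) (sym (rltCarry-even-S≡1 2 refl)))
  }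
  where
  rltCarry-even-S≡1 : ∀ c → S c ≡ 1 → rltCarry c (double m) ≡ rltCarry 0 m
  rltCarry-even-S≡1 c S≡1 = trans (rltCarry-even c m) (trans (cong (_* rltCarry 0 m) S≡1) (*-identityˡ (rltCarry 0 m)))

shiftedTValues-odd : ∀ m → ShiftedTValues m → ShiftedTValues (suc (double m))
shiftedTValues-odd m v = record
  { t₀₋₁ = trans (shiftedT-odd m 0 -1ℤ) (t₁₂ v)
  ; t₀₀  = trans (shiftedT-odd m 0 0ℤ) (trans (cong₂ _+_ (t₀₋₁ v) (t₁₃ v)) (sym (rltCarry-odd 0 m)))
  ; t₀₁  = trans (shiftedT-odd m 0 1ℤ) (trans (t₁₃ v) (sym (rltCarry-odd 0 m)))
  ; t₁₋₁ = trans (shiftedT-odd m 1 -1ℤ) (cong₂ _+_ (t₁₋₁ v) (t₁₂ v))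
  ; t₁₀  = trans (shiftedT-odd m 1 0ℤ) (trans (+-identityʳ _) (t₁₋₁ v))
  ; t₁₁  = trans (shiftedT-odd m 1 1ℤ) (trans (cong₂ _+_ (t₁₀ v) (t₁₃ v)) (sym (rltCarry-odd 0 m)))
  ; t₁₂  = trans (shiftedT-odd m 1 (+ 2)) (trans (+-identityʳ _) (t₁₀ v))
  ; t₁₃  = begin
      shiftedT (suc (double m)) 1 (+ 3)      ≡⟨ shiftedT-odd m 1 (+ 3) ⟩
      shiftedT m 1 1ℤ + shiftedT m 1 (+ 4)   ≡⟨ cong (_+ shiftedT m 1 (+ 4)) (t₁₁ v) ⟩
      rltCarry 0 m + shiftedT m 1 (+ 4)      ≡⟨ +-comm (rltCarry 0 m) _ ⟩
      shiftedT m 1 (+ 4) + rltCarry 0 m      ≡⟨ t₁₄ v ⟩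
      rltCarry 2 m                           ≡⟨ rltCarry-odd 1 m ⟨
      rltCarry 1 (suc (double m))            ∎
  ; t₁₄  = begin
      shiftedT (suc (double m)) 1 (+ 4) + rltCarry 0 (suc (double m))
        ≡⟨ cong₂ _+_ (trans (shiftedT-odd m 1 (+ 4)) (trans (+-identityʳ _) (t₁₁ v))) (rltCarry-odd 0 m) ⟩
      rltCarry 0 m + rltCarry 1 m                         ≡⟨ +-comm (rltCarry 0 m) (rltCarry 1 m) ⟩
      rltCarry 1 m + rltCarry 0 m                         ≡⟨ rltCarry-padovan 0 m ⟨
      rltCarry 3 m                                        ≡⟨ rltCarry-odd 2 m ⟨
      rltCarry 2 (suc (double m))                         ∎
  }
  where open ≡-Reasoning

shiftedTValues : ∀ n → ShiftedTValues n
shiftedTValues = binary-induction ShiftedTValues shiftedTValues-zero step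
  where
  step : ∀ ν m → ShiftedTValues m → ShiftedTValues (bit ν + double m)
  step false = shiftedTValues-even
  step true  = shiftedTValues-odd

theorem12 : (n : ℕ) → Tseq n ≡ runLengthTransform S n
theorem12 n = trans (Tseq≡shiftedT n) (t₀₀ (shiftedTValues n))
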